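{- Let $k \geq 3$ be an integer. If the edge Folkman number $F_e(K_{k+1},K_{k+1}; J_{k+2})$ exists, then the vertex Folkman number $F_v(K_k,K_k;J_{k+1})$ exists.
   Context: All graphs are finite, undirected and simple. $K_n$ is the complete graph on $n$ vertices and $J_n = K_n - e$ is $K_n$ with one edge removed. A graph $G$ is $H$-free if it contains no subgraph isomorphic to $H$. For graphs $G, H_1, H_2$: $G \rightarrow (H_1,H_2)^v$ means that every red-blue coloring of the vertices of $G$ contains a red copy of $H_1$ or a blue copy of $H_2$ (as subgraphs induced on monochromatic vertex sets); $G \rightarrow (H_1,H_2)^e$ means that every red-blue coloring of the edges of $G$ contains a red subgraph isomorphic to $H_1$ or a blue subgraph isomorphic to $H_2$. The vertex Folkman number $F_v(H_1,H_2;H)$ is the smallest $n$ such that there is an $H$-free graph $G$ on $n$ vertices with $G \rightarrow (H_1,H_2)^v$; the edge Folkman number $F_e(H_1,H_2;H)$ is defined analogously with $G \rightarrow (H_1,H_2)^e$. Such a number "exists" if at least one such $H$-free graph exists. -}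

module Defs where

open import Data.Nat using (ℕ; suc; _≥_)
open import Data.Fin using (Fin; zero; suc; toℕ)
open import Data.Bool using (Bool; true; false)
open import Data.Product using (Σ; ∃; _×_; _,_)
open import Relation.Binary.PropositionalEquality using (_≡_; _≢_)
open import Relation.Nullary using (¬_; Dec; yes; no; ¬?)
open import Relation.Nullary.Decidable using (_×-dec_; _⊎-dec_)
open import Data.Fin using (_≟_)
open import Data.Nat using () renaming (_≟_ to _≟ℕ_)
open import Function.Definitions using (Injective)

record Graph (n : ℕ) : Set₁ where
  field
    Adj   : Fin n → Fin n → Set
    sym   : ∀ {x y} → Adj x y → Adj y x
    irrefl : ∀ {x} → ¬ Adj x x
    adj?   : ∀ x y → Dec (Adj x y)
open Graph public

K : (n : ℕ) → Graph n
K n = record { Adj = λ x y → x ≢ y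
             ; sym = λ p q → p (Relation.Binary.PropositionalEquality.sym q)
             ; irrefl = λ p → p Relation.Binary.PropositionalEquality.refl
             ; adj? = λ x y → ¬? (x ≟ y) }
  where import Relation.Binary.PropositionalEquality

IsEdge01 : ∀ {n} → Fin n → Fin n → Set
IsEdge01 x y = (toℕ x ≡ 0 × toℕ y ≡ 1) ⊎' (toℕ x ≡ 1 × toℕ y ≡ 0)
  where
  open import Data.Sum using () renaming (_⊎_ to _⊎'_)

J : (n : ℕ) → Graph n
J n = record
  { Adj = λ x y → (x ≢ y) × ¬ IsEdge01 x y
  ; sym = λ { (p , q) → (λ e → p (≡sym e)) , (λ e → q (swap01 e)) }
  ; irrefl = λ { (p , _) → p ≡refl }
  ; adj? = λ x y → ¬? (x ≟ y) ×-dec ¬? (((toℕ x ≟ℕ 0) ×-dec (toℕ y ≟ℕ 1)) ⊎-dec ((toℕ x ≟ℕ 1) ×-dec (toℕ y ≟ℕ 0))) }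
  where
  open import Relation.Binary.PropositionalEquality using ()
    renaming (sym to ≡sym; refl to ≡refl)
  open import Data.Sum using (inj₁; inj₂)
  swap01 : ∀ {x y} → IsEdge01 {n} y x → IsEdge01 x y
  swap01 (inj₁ (a , b)) = inj₂ (b , a)
  swap01 (inj₂ (a , b)) = inj₁ (b , a)

CopyWithin : ∀ {m n} → Graph m → Graph n → (Fin n → Set) → Set
CopyWithin {m} {n} H G P =
  Σ (Fin m → Fin n) λ f →
    Injective _≡_ _≡_ f ×
    (∀ x y → Adj H x y → Adj G (f x) (f y)) ×
    (∀ x → P (f x))

Contains : ∀ {m n} → Graph m → Graph n → Set
Contains H G = CopyWithin H G (λ _ → Data.Unit.⊤)
  where import Data.Unit

Free : ∀ {m n} → Graph m → Graph n → Set
Free H G = ¬ Contains H G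

-- G → (H₁,H₂)^v : every red/blue vertex colouring (true = red, false = blue)
-- has a red copy of H₁ or a blue copy of H₂ (on monochromatic vertex sets).
VArrows : ∀ {n m₁ m₂} → Graph n → Graph m₁ → Graph m₂ → Set
VArrows G H₁ H₂ = (c : Fin _ → Bool) →
  CopyWithin H₁ G (λ v → c v ≡ true) ⊎ CopyWithin H₂ G (λ v → c v ≡ false)
  where open import Data.Sum using (_⊎_)

MonoEdgeCopy : ∀ {m n} → Graph m → Graph n → (Fin n → Fin n → Bool) → Bool → Set
MonoEdgeCopy {m} {n} H G c b =
  Σ (Fin m → Fin n) λ f →
    Injective _≡_ _≡_ f ×
    (∀ x y → Adj H x y → Adj G (f x) (f y) × c (f x) (f y) ≡ b)

-- G → (H₁,H₂)^e : every red/blue edge colouring (a symmetric function on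
-- pairs of vertices; only its values on edges matter) has a red copy of H₁
-- or a blue copy of H₂.
EArrows : ∀ {n m₁ m₂} → Graph n → Graph m₁ → Graph m₂ → Set
EArrows {n} G H₁ H₂ = (c : Fin n → Fin n → Bool) → (∀ x y → c x y ≡ c y x) →
  MonoEdgeCopy H₁ G c true ⊎ MonoEdgeCopy H₂ G c false
  where open import Data.Sum using (_⊎_)

FvExists : ∀ {m₁ m₂ m} → Graph m₁ → Graph m₂ → Graph m → Set₁
FvExists H₁ H₂ H = ∃ λ n → Σ (Graph n) λ G → Free H G × VArrows G H₁ H₂

FeExists : ∀ {m₁ m₂ m} → Graph m₁ → Graph m₂ → Graph m → Set₁
FeExists H₁ H₂ H = ∃ λ n → Σ (Graph n) λ G → Free H G × EArrows G H₁ H₂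

module Submission where

-- Let G be J_{k+2}-free with G → (K_{k+1}, K_{k+1})^e, and let L be the disjoint union of the
-- links G[N(v)] of all vertices v. Colour each edge vw of G, v < w, by the colour of w in the
-- link of v: a monochromatic K_{k+1} of G then gives a monochromatic K_k in the link of its
-- least vertex, so L → (K_k, K_k)^v. And L is J_{k+1}-free: J_{k+1} is connected, so a copy
-- lies in a single link G[N(v)], and adding v to it gives a J_{k+2} in G.

open import Defs
open import Data.Nat using (ℕ; suc; _≥_; _*_; s≤s)
open import Data.Fin using (Fin; zero; suc; toℕ; _≤_; _≤?_; _≟_; combine; remQuot; punchIn; punchOut)
open import Data.Fin.Properties
  using (≤-total; ≤-antisym; ≤-totalOrder; remQuot-combine; combine-remQuot; combine-injectiveʳ;
         punchIn-injective; punchInᵢ≢i; punchIn-punchOut; punchOut-injective)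
open import Data.Bool using (Bool)
import Data.Product as Product
open import Data.Product using (∃; _×_; _,_; proj₁; proj₂)
open import Data.Sum using (inj₁; inj₂)
import Data.Sum as Sum
open import Data.List using (allFin)
open import Data.List.Membership.Propositional.Properties using (∈-allFin)
import Data.List.Relation.Unary.All as All
open import Function using (_∘_)
open import Relation.Binary.PropositionalEquality
  using (_≡_; _≢_; refl; cong; cong₂; subst; subst₂; trans; module ≡-Reasoning) renaming (sym to ≡-sym)
open import Relation.Nullary using (Dec; yes; no; contradiction)
open import Relation.Nullary.Decidable using (map′; _×-dec_)

minimiser : ∀ {k n} (f : Fin (suc k) → Fin n) → ∃ λ i → ∀ j → f i ≤ f j
minimiser {k} {n} f = i , λ j → All.lookup (f[argmin]≤f[xs] {f = f} zero (allFin _)) (∈-allFin j)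
  where
  open import Data.List.Extrema (≤-totalOrder n)
  i : Fin (suc k)
  i = argmin f zero (allFin _)

record LinkAdj {n} (G : Graph n) (p q : Fin n × Fin n) : Set where
  constructor link
  field
    same-apex : proj₁ p ≡ proj₁ q
    apex-adjˡ : Adj G (proj₁ p) (proj₂ p)
    apex-adjʳ : Adj G (proj₁ q) (proj₂ q)
    tips-adj  : Adj G (proj₂ p) (proj₂ q)
open LinkAdj

LinkAdj? : ∀ {n} (G : Graph n) p q → Dec (LinkAdj G p q)
LinkAdj? G (v , w) (v′ , w′) =
  map′ (λ (e , p , q , r) → link e p q r) (λ (link e p q r) → e , p , q , r)
       ((v ≟ v′) ×-dec adj? G v w ×-dec adj? G v′ w′ ×-dec adj? G w w′)

split : ∀ {n} → Fin (n * n) → Fin n × Fin n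
split {n} = remQuot {n} n

-- The vertex combine v w of Links G stands for w as a vertex of the link of v.
Links : ∀ {n} → Graph n → Graph (n * n)
Links G = record
  { Adj    = λ a b → LinkAdj G (split a) (split b)
  ; sym    = λ (link e p q r) → link (≡-sym e) q p (sym G r)
  ; irrefl = λ e → irrefl G (tips-adj e)
  ; adj?   = λ a b → LinkAdj? G (split a) (split b)
  }

Links-adj : ∀ {n} {G : Graph n} {v w w′} → Adj G v w → Adj G v w′ → Adj G w w′ →
            Adj (Links G) (combine v w) (combine v w′)
Links-adj {v = v} {w} {w′} p q r
  rewrite remQuot-combine v w | remQuot-combine v w′ = link refl p q r

edgeColouring : ∀ {n} → (Fin (n * n) → Bool) → Fin n → Fin n → Bool
edgeColouring χ x y with x ≤? y
... | yes _ = χ (combine x y)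
... | no  _ = χ (combine y x)

edgeColouring-≤ : ∀ {n} (χ : Fin (n * n) → Bool) {x y : Fin n} →
                  x ≤ y → edgeColouring χ x y ≡ χ (combine x y)
edgeColouring-≤ χ {x} {y} x≤y with x ≤? y
... | yes _   = refl
... | no  x≰y = contradiction x≤y x≰y

edgeColouring-sym : ∀ {n} (χ : Fin (n * n) → Bool) (x y : Fin n) →
                    edgeColouring χ x y ≡ edgeColouring χ y x
edgeColouring-sym χ x y with x ≤? y | y ≤? x
... | yes x≤y | yes y≤x with refl ← ≤-antisym x≤y y≤x = refl
... | yes _   | no  _   = refl
... | no  _   | yes _   = refl
... | no  x≰y | no  y≰x = contradiction (≤-total x y) Sum.[ x≰y , y≰x ]

-- Seen from its least vertex i, the clique f becomes a clique in the link of f i whose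
-- vertex colours are the edge colours at f i.
monoClique⇒linkClique : ∀ {k n} {G : Graph n} {χ : Fin (n * n) → Bool} {b} →
  MonoEdgeCopy (K (suc k)) G (edgeColouring χ) b → CopyWithin (K k) (Links G) (λ a → χ a ≡ b)
monoClique⇒linkClique {k} {n} {G} {χ} {b} (f , f-inj , f-mono) = g , g-inj , g-adj , g-colour
  where
  i : Fin (suc k)
  i = proj₁ (minimiser f)

  i≢punchIn : ∀ j → i ≢ punchIn i j
  i≢punchIn j = punchInᵢ≢i i j ∘ ≡-sym

  edge : ∀ {x y} → x ≢ y → Adj G (f x) (f y) × edgeColouring χ (f x) (f y) ≡ b
  edge = f-mono _ _

  g : Fin k → Fin (n * n)
  g j = combine (f i) (f (punchIn i j))

  g-inj : ∀ {j j′} → g j ≡ g j′ → j ≡ j′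
  g-inj eq = punchIn-injective i _ _ (f-inj (combine-injectiveʳ (f i) _ (f i) _ eq))

  g-adj : ∀ j j′ → j ≢ j′ → Adj (Links G) (g j) (g j′)
  g-adj j j′ j≢j′ = Links-adj (proj₁ (edge (i≢punchIn j))) (proj₁ (edge (i≢punchIn j′)))
                              (proj₁ (edge (j≢j′ ∘ punchIn-injective i j j′)))

  g-colour : ∀ j → χ (g j) ≡ b
  g-colour j = trans (≡-sym (edgeColouring-≤ χ (proj₂ (minimiser f) _)))
                     (proj₂ (edge (i≢punchIn j)))

Links-vertexArrows : ∀ {k n} {G : Graph n} →
  EArrows G (K (suc k)) (K (suc k)) → VArrows (Links G) (K k) (K k)
Links-vertexArrows arrows χ =
  Sum.map monoClique⇒linkClique monoClique⇒linkClique (arrows (edgeColouring χ) (edgeColouring-sym χ))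

-- A connected copy lies in a single link; a dominating vertex c makes this immediate.
linkCopy⇒neighbourhoodCopy : ∀ {r n} {H : Graph r} {G : Graph n} (c d : Fin r) →
  (∀ x → x ≢ c → Adj H x c) → d ≢ c →
  Contains H (Links G) → ∃ λ v → CopyWithin H G (Adj G v)
linkCopy⇒neighbourhoodCopy {r} {n} {G = G} c d dominating d≢c (g , g-inj , g-adj , _) =
  apex c , tip , tip-inj , (λ x y → tips-adj ∘ g-adj x y) , apex-adj
  where
  apex tip : Fin r → Fin n
  apex x = proj₁ (split (g x))
  tip  x = proj₂ (split (g x))

  apex≡ : ∀ x → apex x ≡ apex c
  apex≡ x with x ≟ c
  ... | yes refl = refl
  ... | no  x≢c  = same-apex (g-adj x c (dominating x x≢c))

  tip-inj : ∀ {x y} → tip x ≡ tip y → x ≡ y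
  tip-inj {x} {y} eq = g-inj (begin
    g x                          ≡⟨ combine-remQuot {n} n (g x) ⟨
    combine (apex x) (tip x)     ≡⟨ cong₂ combine (trans (apex≡ x) (≡-sym (apex≡ y))) eq ⟩
    combine (apex y) (tip y)     ≡⟨ combine-remQuot {n} n (g y) ⟩
    g y                          ∎)
    where open ≡-Reasoning

  apex-adj : ∀ x → Adj G (apex c) (tip x)
  apex-adj x with x ≟ c
  ... | yes refl = apex-adjʳ (g-adj d c (dominating d d≢c))
  ... | no  x≢c  = subst (λ v → Adj G v (tip x)) (apex≡ x)
                          (apex-adjˡ (g-adj x c (dominating x x≢c)))

coneCopy : ∀ {r n} {H′ : Graph (suc r)} {H : Graph r} {G : Graph n} (i : Fin (suc r)) →
  (∀ x y → Adj H′ (punchIn i x) (punchIn i y) → Adj H x y) →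
  ∀ {v} → CopyWithin H G (Adj G v) → Contains H′ G
coneCopy {r} {n} {H′} {G = G} i H′-i⊆H {v} (f , f-inj , f-adj , f-nbr) = h , h-inj , h-adj , _
  where
  h : Fin (suc r) → Fin n
  h x with i ≟ x
  ... | yes _   = v
  ... | no  i≢x = f (punchOut i≢x)

  v≢f : ∀ x → v ≢ f x
  v≢f x v≡fx = irrefl G (subst (Adj G v) (≡-sym v≡fx) (f-nbr x))

  h-inj : ∀ {x y} → h x ≡ h y → x ≡ y
  h-inj {x} {y} eq with i ≟ x | i ≟ y
  ... | yes refl | yes refl = refl
  ... | yes _    | no  _    = contradiction eq (v≢f _)
  ... | no  _    | yes _    = contradiction (≡-sym eq) (v≢f _)
  ... | no  i≢x  | no  i≢y  = punchOut-injective i≢x i≢y (f-inj eq)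

  h-adj : ∀ x y → Adj H′ x y → Adj G (h x) (h y)
  h-adj x y xy with i ≟ x | i ≟ y
  ... | yes refl | yes refl = contradiction xy (irrefl H′)
  ... | yes _    | no  _    = f-nbr _
  ... | no  _    | yes _    = sym G (f-nbr _)
  ... | no  i≢x  | no  i≢y  = f-adj _ _ (H′-i⊆H _ _
    (subst₂ (Adj H′) (≡-sym (punchIn-punchOut i≢x)) (≡-sym (punchIn-punchOut i≢y)) xy))

two : ∀ {r} → Fin (suc (suc (suc r)))
two = suc (suc zero)

J-adj-two : ∀ {r} (x : Fin (suc (suc (suc r)))) → x ≢ two → Adj (J (suc (suc (suc r)))) x two
J-adj-two x x≢two = x≢two , λ { (inj₁ (_ , ())) ; (inj₂ (_ , ())) }

punchIn-two-fixes-0 : ∀ {r} {x : Fin (suc (suc r))} → toℕ x ≡ 0 → toℕ (punchIn two x) ≡ 0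
punchIn-two-fixes-0 {x = zero}  _ = refl
punchIn-two-fixes-0 {x = suc _} ()

punchIn-two-fixes-1 : ∀ {r} {x : Fin (suc (suc r))} → toℕ x ≡ 1 → toℕ (punchIn two x) ≡ 1
punchIn-two-fixes-1 {x = suc zero}    _ = refl
punchIn-two-fixes-1 {x = zero}        ()
punchIn-two-fixes-1 {x = suc (suc _)} ()

J-minus-two⊆J : ∀ {r} (x y : Fin (suc (suc r))) →
  Adj (J (suc (suc (suc r)))) (punchIn two x) (punchIn two y) → Adj (J (suc (suc r))) x y
J-minus-two⊆J x y (x≢y , not01) =
  x≢y ∘ cong (punchIn two) ,
  not01 ∘ Sum.map (Product.map punchIn-two-fixes-0 punchIn-two-fixes-1)
                  (Product.map punchIn-two-fixes-1 punchIn-two-fixes-0)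

Links-J-free : ∀ {r n} {G : Graph n} →
  Free (J (suc (suc (suc (suc r))))) G → Free (J (suc (suc (suc r)))) (Links G)
Links-J-free {G = G} free copy
  with linkCopy⇒neighbourhoodCopy {H = J _} {G = G} two zero J-adj-two (λ ()) copy
... | _ , inLink = free (coneCopy {H′ = J _} {H = J _} {G = G} two J-minus-two⊆J inLink)

theorem2 : (k : ℕ) → k ≥ 3 →
    FeExists (K (suc k)) (K (suc k)) (J (suc (suc k))) →
    FvExists (K k) (K k) (J (suc k))
theorem2 (suc (suc (suc _))) (s≤s (s≤s (s≤s _))) (n , G , J-free , arrows) =
  n * n , Links G , Links-J-free J-free , Links-vertexArrows arrows
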